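{- Let $L$ be a lattice data structure of height $h\ge1$ whose diagonal $h+2$ contains exactly $k$ proper keys, $1\le k\le h$, and search $L$ with SearchLDS, where the number of comparisons of a search is the number of cells visited (including the starting cell and the cell at which the search stops). Then (1) for every positive integer $K$ that is not a proper key of $L$, the number of comparisons is $h+1$; (2) for every proper key $K$ of $L$, the number of comparisons is at most $h$; (3) the average, over all proper keys $K$ of $L$ (each counted once), of the number of comparisons is $$\frac{2h^3-2h+3k^2+3k}{3h^2-3h+6k}.$$
   Context: Diagram of height $h$: cells $(r,c)$ of positive integers with $r+c\le h+4$; $r$ is the row (numbered bottom to top), $c$ the column (left to right). Diagonal $k$ ($1\le k\le h+3$) is the set of cells with $r+c=k+1$, numbered from head $(k,1)$ to tail $(1,k)$, its $j$-th cell being $(k+1-j,j)$. A lattice data structure (LDS) of height $h$ assigns to each cell an entry in $\{0,\infty\}\cup\mathbb{Z}_{>0}$ such that: (1) all cells of row $1$ and column $1$ contain $0$; (2) all cells of diagonal $h+3$ except head and tail contain $\infty$; (3) for some $0\le m\le h-1$, exactly the cells $(h+3-j,j)$ of diagonal $h+2$ with $h+2-m\le j\le h+1$ contain $\infty$; (4) all remaining cells contain pairwise distinct positive integers (proper keys); (5) proper keys are strictly increasing along each row (left to right), column (bottom to top) and diagonal (head to tail). Order convention: $0<n<\infty$ for every positive integer $n$. For a cell $C=(r,c)$ write $D=(r-1,c)$ and $DR=(r-1,c+1)$. SearchLDS, given $L$ and a positive integer $K$: start at cell $(h+1,2)$ (the second cell of diagonal $h+2$); repeatedly, if the entry of the current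 cell equals $K$, stop ($K$ present); if it equals $0$, stop ($K$ absent); otherwise move to $DR$ if $K$ is greater than the entry and to $D$ if $K$ is smaller. -}

module Defs where

open import Data.Nat using (ℕ; zero; suc; _+_; _∸_; _≤_; _<_; _≟_; _<?_)
open import Data.List using (List; []; _∷_; map; concatMap; upTo)
open import Data.Product using (Σ; _×_; _,_; proj₂)
open import Relation.Binary.PropositionalEquality using (_≡_)
open import Relation.Nullary using (¬_; yes; no)

data Entry : Set where
  fin : ℕ → Entry
  ∞   : Entry

-- A filling of cells: L r c is the entry at cell (r , c) (row r, column c).
-- Only cells of the diagram matter.
Filling : Set
Filling = ℕ → ℕ → Entry

InD : ℕ → ℕ → ℕ → Set
InD h r c = (1 ≤ r) × (1 ≤ c) × (r + c ≤ h + 4)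

KeyAt : ℕ → Filling → ℕ → ℕ → ℕ → Set
KeyAt h L r c n = InD h r c × (0 < n) × (L r c ≡ fin n)

IsProperKey : ℕ → Filling → ℕ → Set
IsProperKey h L K = Σ ℕ λ r → Σ ℕ λ c → KeyAt h L r c K

-- Lattice data structure of height h (conditions (1)-(5)).
-- Diagonal d consists of cells with r + c = d + 1; its j-th cell is (d+1-j , j),
-- so "j-th cell" has column j.
record IsLDS (h : ℕ) (L : Filling) : Set where
  field
    m        : ℕ
    m≤h-1    : m + 1 ≤ h
    row1     : ∀ c → InD h 1 c → L 1 c ≡ fin 0
    col1     : ∀ r → InD h r 1 → L r 1 ≡ fin 0
    -- (2) diagonal h+3 (r + c = h + 4), except head and tail
    diagTop  : ∀ r c → 2 ≤ r → 2 ≤ c → r + c ≡ h + 4 → L r c ≡ ∞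
    -- (3) diagonal h+2 (r + c = h + 3): cells with h+2-m ≤ j ≤ h+1 contain ∞
    diagNext : ∀ r c → 2 ≤ r → r + c ≡ h + 3 → h + 2 ≤ c + m → L r c ≡ ∞
    rest     : ∀ r c → 2 ≤ r → 2 ≤ c → r + c ≤ h + 3 →
               ¬ ((r + c ≡ h + 3) × (h + 2 ≤ c + m)) →
               Σ ℕ λ n → (0 < n) × (L r c ≡ fin n)
    distinct : ∀ r c r' c' n → KeyAt h L r c n → KeyAt h L r' c' n →
               (r ≡ r') × (c ≡ c')
    rowInc   : ∀ r c c' n n' → KeyAt h L r c n → KeyAt h L r c' n' → c < c' → n < n'
    colInc   : ∀ r r' c n n' → KeyAt h L r c n → KeyAt h L r' c n' → r < r' → n < n'
    diagInc  : ∀ r c r' c' n n' → KeyAt h L r c n → KeyAt h L r' c' n' →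
               r + c ≡ r' + c' → c < c' → n < n'

data Outcome : Set where
  present absent : Outcome

private
  tick : Outcome × ℕ → Outcome × ℕ
  tick (o , s) = o , suc s

-- Every move goes down one row, so recursion on the row terminates; row 1 is all 0,
-- so the clause for row 0 is never reached on an LDS.
search : Filling → ℕ → ℕ → ℕ → Outcome × ℕ
search L K zero c = absent , 0
search L K (suc r) c with L (suc r) c
... | ∞ = tick (search L K r c)                     -- K < ∞ : move to D
... | fin zero = absent , 1
... | fin (suc n) with K ≟ suc n
...   | yes _ = present , 1
...   | no _ with suc n <? K
...     | yes _ = tick (search L K r (suc c))       -- K > entry : move to DR
...     | no _  = tick (search L K r c)             -- K < entry : move to D

searchLDS : ℕ → Filling → ℕ → Outcome × ℕ
searchLDS h L K = search L K (h + 1) 2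

comparisons : ℕ → Filling → ℕ → ℕ
comparisons h L K = proj₂ (searchLDS h L K)

cells : ℕ → List (ℕ × ℕ)
cells h = concatMap (λ r → map (λ c → r , c) (map suc (upTo (h + 4 ∸ r))))
                    (map suc (upTo (h + 3)))

keyOf : Entry → List ℕ
keyOf (fin zero)    = []
keyOf (fin (suc n)) = suc n ∷ []
keyOf ∞             = []

properKeys : ℕ → Filling → List ℕ
properKeys h L = concatMap (λ p → keyOf (L (Data.Product.proj₁ p) (proj₂ p))) (cells h)

diagKeys : ℕ → Filling → List ℕ
diagKeys h L = concatMap (λ j → keyOf (L (h + 3 ∸ j) j)) (map suc (upTo (h + 2)))

module Submission where

-- Every step of SearchLDS moves down one row, so a search costs one comparison per row it visits.
-- The cell of a proper key K stays reachable from the current cell by moves to D and DR (a wrong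
-- turn would contradict the monotonicity of rows, columns or diagonals), so the search stops at K
-- after h + 2 − r comparisons when K lies in row r; an absent key is never met and the search runs
-- down to row 1, after h + 1 comparisons. Row h + 2 − j (1 ≤ j ≤ h) holds j − 1 keys below
-- diagonal h + 2, plus one on it exactly when j ≤ k. Hence the keys cost
-- Σ j (j − 1 + [j ≤ k]) = (h³ − h)/3 + k(k + 1)/2 comparisons in total, and there are
-- Σ (j − 1 + [j ≤ k]) = h(h − 1)/2 + k of them.

open import Defs
open import Data.Nat using (ℕ; _≤_; _+_)
open import Data.List using (length; map)
open import Data.Nat.ListAction using (sum)
open import Data.Product using (_×_; _,_)
open import Relation.Binary.PropositionalEquality using (_≡_)
open import Relation.Nullary using (¬_)

module Sums where
  open import Data.Nat using (zero; suc; _*_; _∸_; _<_; _≤?_; z≤n; s≤s)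
  open import Data.Nat.Properties
  open import Data.Nat.ListAction.Properties using (sum-++)
  open import Data.Nat.Tactic.RingSolver using (solve-∀)
  open import Data.List using (List; []; _∷_; _++_; _∷ʳ_; concatMap; upTo)
  open import Data.List.Properties using (map-++; upTo-∷ʳ)
  open import Data.Sum using (inj₁; inj₂)
  open import Data.Empty using (⊥-elim)
  open import Relation.Binary.PropositionalEquality
    using (refl; trans; cong; cong₂; subst; module ≡-Reasoning)
  open import Relation.Nullary using (yes; no)

  sumTo : ℕ → (ℕ → ℕ) → ℕ
  sumTo zero    f = 0
  sumTo (suc n) f = sumTo n f + f (suc n)

  sum-map-upTo : ∀ (f : ℕ → ℕ) n → sum (map f (map suc (upTo n))) ≡ sumTo n f
  sum-map-upTo f zero = refl
  sum-map-upTo f (suc n) = begin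
    sum (map f (map suc (upTo (suc n))))
      ≡⟨ cong (λ xs → sum (map f (map suc xs))) (upTo-∷ʳ n) ⟨
    sum (map f (map suc (upTo n ∷ʳ n)))
      ≡⟨ cong (λ xs → sum (map f xs)) (map-++ suc (upTo n) (n ∷ [])) ⟩
    sum (map f (map suc (upTo n) ∷ʳ suc n))
      ≡⟨ cong sum (map-++ f (map suc (upTo n)) (suc n ∷ [])) ⟩
    sum (map f (map suc (upTo n)) ∷ʳ f (suc n))
      ≡⟨ sum-++ (map f (map suc (upTo n))) (f (suc n) ∷ []) ⟩
    sum (map f (map suc (upTo n))) + (f (suc n) + 0)
      ≡⟨ cong₂ _+_ (sum-map-upTo f n) (+-identityʳ (f (suc n))) ⟩
    sumTo n f + f (suc n) ∎
    where open ≡-Reasoning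

  length≡sum-map-const : ∀ {A : Set} (xs : List A) → length xs ≡ sum (map (λ _ → 1) xs)
  length≡sum-map-const []       = refl
  length≡sum-map-const (_ ∷ xs) = cong suc (length≡sum-map-const xs)

  sum-map-concatMap : ∀ {A B : Set} (f : B → ℕ) (g : A → List B) xs →
                      sum (map f (concatMap g xs)) ≡ sum (map (λ x → sum (map f (g x))) xs)
  sum-map-concatMap f g [] = refl
  sum-map-concatMap f g (x ∷ xs) = begin
    sum (map f (g x ++ concatMap g xs))
      ≡⟨ cong sum (map-++ f (g x) (concatMap g xs)) ⟩
    sum (map f (g x) ++ map f (concatMap g xs))
      ≡⟨ sum-++ (map f (g x)) (map f (concatMap g xs)) ⟩
    sum (map f (g x)) + sum (map f (concatMap g xs))
      ≡⟨ cong (sum (map f (g x)) +_) (sum-map-concatMap f g xs) ⟩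
    sum (map f (g x)) + sum (map (λ x → sum (map f (g x))) xs) ∎
    where open ≡-Reasoning

  sumTo-cong : ∀ n {f g : ℕ → ℕ} → (∀ i → 1 ≤ i → i ≤ n → f i ≡ g i) → sumTo n f ≡ sumTo n g
  sumTo-cong zero    f≗g = refl
  sumTo-cong (suc n) f≗g =
    cong₂ _+_ (sumTo-cong n λ i 1≤i i≤n → f≗g i 1≤i (≤-trans i≤n (n≤1+n n))) (f≗g (suc n) (s≤s z≤n) ≤-refl)

  sumTo-+ : ∀ n (f g : ℕ → ℕ) → sumTo n (λ i → f i + g i) ≡ sumTo n f + sumTo n g
  sumTo-+ zero    f g = refl
  sumTo-+ (suc n) f g rewrite sumTo-+ n f g = +-assoc-middle (sumTo n f) (sumTo n g) (f (suc n)) (g (suc n))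
    where
    +-assoc-middle : ∀ a b c d → a + b + (c + d) ≡ a + c + (b + d)
    +-assoc-middle = solve-∀

  sumTo-const : ∀ n w → sumTo n (λ _ → w) ≡ n * w
  sumTo-const zero    w = refl
  sumTo-const (suc n) w rewrite sumTo-const n w = +-comm (n * w) w

  sumTo-suc : ∀ n (f : ℕ → ℕ) → sumTo (suc n) f ≡ f 1 + sumTo n (λ i → f (suc i))
  sumTo-suc zero    f = +-comm 0 (f 1)
  sumTo-suc (suc n) f rewrite sumTo-suc n f = +-assoc (f 1) _ _

  sumTo-reverse : ∀ n (f : ℕ → ℕ) → sumTo n f ≡ sumTo n (λ i → f (suc n ∸ i))
  sumTo-reverse zero    f = refl
  sumTo-reverse (suc n) f rewrite sumTo-suc n (λ i → f (suc (suc n) ∸ i)) | sumTo-reverse n f =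
    +-comm _ (f (suc n))

  sumTo-reflect : ∀ n {f g : ℕ → ℕ} → (∀ i j → 1 ≤ i → 1 ≤ j → i + j ≡ suc n → f i ≡ g j) →
                  sumTo n f ≡ sumTo n g
  sumTo-reflect n {f} {g} f~g = trans (sumTo-reverse n f) (sumTo-cong n λ j 1≤j j≤n →
    f~g (suc n ∸ j) j (m<n⇒0<n∸m (s≤s j≤n)) 1≤j (m∸n+n≡m (≤-trans j≤n (n≤1+n n))))

  +-≤-from-∸ : ∀ {r c n} → 1 ≤ c → c ≤ n ∸ r → r + c ≤ n
  +-≤-from-∸ {r} {c} {n} 1≤c c≤n∸r with r ≤? n
  ... | yes r≤n = subst (_≤ n) (+-comm c r) (m≤o∸n⇒m+n≤o c r≤n c≤n∸r)
  ... | no r≰n  = ⊥-elim (<⇒≱ 1≤c (subst (c ≤_) (m≤n⇒m∸n≡0 (<⇒≤ (≰⇒> r≰n))) c≤n∸r))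

  [_≤_] : ℕ → ℕ → ℕ
  [ zero  ≤ b     ] = 1
  [ suc a ≤ zero  ] = 0
  [ suc a ≤ suc b ] = [ a ≤ b ]

  [≤]-yes : ∀ {a b} → a ≤ b → [ a ≤ b ] ≡ 1
  [≤]-yes {zero}  _         = refl
  [≤]-yes {suc a} (s≤s a≤b) = [≤]-yes a≤b

  [≤]-no : ∀ {a b} → b < a → [ a ≤ b ] ≡ 0
  [≤]-no {suc a} {zero}  _         = refl
  [≤]-no {suc a} {suc b} (s≤s b<a) = [≤]-no b<a

  sumTo-truncate : ∀ {k} n (f : ℕ → ℕ) → k ≤ n → sumTo n (λ j → [ j ≤ k ] * f j) ≡ sumTo k f
  sumTo-truncate zero f z≤n = refl
  sumTo-truncate {k} (suc n) f k≤1+n with m≤n⇒m<n∨m≡n k≤1+n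
  ... | inj₁ k<1+n rewrite [≤]-no {suc n} {k} k<1+n =
    trans (+-identityʳ _) (sumTo-truncate n f (≤-pred k<1+n))
  ... | inj₂ refl rewrite [≤]-yes {n} {n} ≤-refl =
    cong₂ _+_ (sumTo-cong n λ j _ j≤n → trans (cong (_* f j) ([≤]-yes (≤-trans j≤n (n≤1+n n))))
                                               (+-identityʳ (f j)))
              (+-identityʳ (f (suc n)))

  sumTo-pronic : ∀ n → 3 * sumTo n (λ j → (j ∸ 1) * j) + n ≡ n * n * n
  sumTo-pronic zero    = refl
  sumTo-pronic (suc n) = begin
    3 * (S + n * suc n) + suc n            ≡⟨ split S n ⟩
    (3 * S + n) + (3 * (n * suc n) + 1)    ≡⟨ cong (_+ (3 * (n * suc n) + 1)) (sumTo-pronic n) ⟩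
    n * n * n + (3 * (n * suc n) + 1)      ≡⟨ cube n ⟩
    suc n * suc n * suc n                  ∎
    where
    open ≡-Reasoning
    S = sumTo n (λ j → (j ∸ 1) * j)
    split : ∀ S n → 3 * (S + n * suc n) + suc n ≡ (3 * S + n) + (3 * (n * suc n) + 1)
    split = solve-∀
    cube : ∀ n → n * n * n + (3 * (n * suc n) + 1) ≡ suc n * suc n * suc n
    cube = solve-∀

  sumTo-pred : ∀ n → 2 * sumTo n (λ j → (j ∸ 1) * 1) + n ≡ n * n
  sumTo-pred zero    = refl
  sumTo-pred (suc n) = begin
    2 * (S + n * 1) + suc n   ≡⟨ split S n ⟩
    (2 * S + n) + (2 * n + 1) ≡⟨ cong (_+ (2 * n + 1)) (sumTo-pred n) ⟩
    n * n + (2 * n + 1)       ≡⟨ square n ⟩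
    suc n * suc n             ∎
    where
    open ≡-Reasoning
    S = sumTo n (λ j → (j ∸ 1) * 1)
    split : ∀ S n → 2 * (S + n * 1) + suc n ≡ (2 * S + n) + (2 * n + 1)
    split = solve-∀
    square : ∀ n → n * n + (2 * n + 1) ≡ suc n * suc n
    square = solve-∀

  sumTo-id : ∀ n → 2 * sumTo n (λ j → j) ≡ n * suc n
  sumTo-id zero    = refl
  sumTo-id (suc n) = begin
    2 * (S + suc n)             ≡⟨ *-distribˡ-+ 2 S (suc n) ⟩
    2 * S + 2 * suc n           ≡⟨ cong (_+ 2 * suc n) (sumTo-id n) ⟩
    n * suc n + 2 * suc n       ≡⟨ *-distribʳ-+ (suc n) n 2 ⟨
    (n + 2) * suc n             ≡⟨ *-comm (n + 2) (suc n) ⟩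
    suc n * (n + 2)             ≡⟨ cong (suc n *_) (+-comm n 2) ⟩
    suc n * suc (suc n)         ∎
    where
    open ≡-Reasoning
    S = sumTo n (λ j → j)


module LDS where
  open Sums
  open import Data.Nat using (zero; suc; _*_; _∸_; _<_; _≟_; _≤?_; _<?_; z≤n; s≤s)
  open import Data.Nat.Properties
  open import Data.Nat.Tactic.RingSolver using (solve-∀)
  open import Data.List using (List; concatMap; upTo)
  open import Data.List.Properties using (map-∘; map-cong)
  open import Data.Product using (proj₁; proj₂)
  open import Data.Sum using (_⊎_; inj₁; inj₂)
  open import Data.Empty using (⊥-elim)
  open import Relation.Binary.PropositionalEquality
    using (_≢_; refl; sym; trans; cong; cong₂; subst; subst₂; module ≡-Reasoning)
  open import Relation.Nullary using (yes; no)
  open import Relation.Nullary.Decidable using (_×-dec_)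

  fin≢∞ : ∀ {n} → fin n ≢ ∞
  fin≢∞ ()

  fin-injective : ∀ {m n} → fin m ≡ fin n → m ≡ n
  fin-injective refl = refl

  Interior : ℕ → ℕ → ℕ → Set
  Interior h r c = (2 ≤ r) × (2 ≤ c) × (r + c ≤ h + 3)

  interior-bounds : ∀ {h r c} → Interior h r c → (r ≤ h + 1) × (c ≤ h + 1)
  interior-bounds {h} {r} {c} (2≤r , 2≤c , r+c≤) =
    +-cancelʳ-≤ 2 r (h + 1) (≤-trans (+-monoʳ-≤ r 2≤c) r+c≤h+1+2) ,
    +-cancelʳ-≤ 2 c (h + 1) (≤-trans (+-monoʳ-≤ c 2≤r) (subst (_≤ h + 1 + 2) (+-comm r c) r+c≤h+1+2))
    where
    r+c≤h+1+2 : r + c ≤ h + 1 + 2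
    r+c≤h+1+2 = subst (r + c ≤_) (sym (+-assoc h 1 2)) r+c≤

  beyond-interior : ∀ {h r c} → h + 2 ≤ r ⊎ h + 2 ≤ c → ¬ Interior h r c
  beyond-interior {h} {r} {c} far int = <⇒≱ (+-monoʳ-< h ≤-refl) (h+2≤h+1 far)
    where
    h+2≤h+1 : h + 2 ≤ r ⊎ h + 2 ≤ c → h + 2 ≤ h + 1
    h+2≤h+1 (inj₁ h+2≤r) = ≤-trans h+2≤r (proj₁ (interior-bounds int))
    h+2≤h+1 (inj₂ h+2≤c) = ≤-trans h+2≤c (proj₂ (interior-bounds int))

  -- (r₀ , c₀) can be reached from (r , c) by moves to D and DR.
  Reachable : ℕ → ℕ → ℕ → ℕ → Set
  Reachable r c r₀ c₀ = (r₀ ≤ r) × (c ≤ c₀) × (r₀ + c₀ ≤ r + c)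

  cellWeight : Filling → (ℕ → ℕ) → ℕ → ℕ → ℕ
  cellWeight L F r c = sum (map F (keyOf (L r c)))

  cellWeight-key : ∀ {L F r c n} → L r c ≡ fin (suc n) → cellWeight L F r c ≡ F (suc n)
  cellWeight-key {F = F} eq = trans (cong (λ e → sum (map F (keyOf e))) eq) (+-identityʳ _)

  rowWeight : ℕ → Filling → (ℕ → ℕ) → ℕ → ℕ
  rowWeight h L F r = sumTo (h + 4 ∸ r) (cellWeight L F r)

  sum-map-properKeys : ∀ h L (F : ℕ → ℕ) → sum (map F (properKeys h L)) ≡ sumTo (h + 3) (rowWeight h L F)
  sum-map-properKeys h L F = begin
    sum (map F (properKeys h L))
      ≡⟨ sum-map-concatMap F (λ p → keyOf (L (proj₁ p) (proj₂ p))) (cells h) ⟩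
    sum (map (λ p → cellWeight L F (proj₁ p) (proj₂ p)) (cells h))
      ≡⟨ sum-map-concatMap (λ p → cellWeight L F (proj₁ p) (proj₂ p)) row (map suc (upTo (h + 3))) ⟩
    sum (map (λ r → sum (map (λ p → cellWeight L F (proj₁ p) (proj₂ p)) (row r))) (map suc (upTo (h + 3))))
      ≡⟨ cong sum (map-cong rowSum (map suc (upTo (h + 3)))) ⟩
    sum (map (rowWeight h L F) (map suc (upTo (h + 3))))
      ≡⟨ sum-map-upTo (rowWeight h L F) (h + 3) ⟩
    sumTo (h + 3) (rowWeight h L F) ∎
    where
    open ≡-Reasoning
    row : ℕ → List (ℕ × ℕ)
    row r = map (r ,_) (map suc (upTo (h + 4 ∸ r)))
    rowSum : ∀ r → sum (map (λ p → cellWeight L F (proj₁ p) (proj₂ p)) (row r)) ≡ rowWeight h L F r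
    rowSum r = trans (cong sum (sym (map-∘ (map suc (upTo (h + 4 ∸ r))))))
                     (sum-map-upTo (cellWeight L F r) (h + 4 ∸ r))

  -- Row h + 2 − j of a lattice data structure with k keys on diagonal h + 2 holds keysAtLevel k j
  -- proper keys, each of which SearchLDS finds after j comparisons.
  keysAtLevel : ℕ → ℕ → ℕ
  keysAtLevel k j = (j ∸ 1) + [ j ≤ k ]

  sumTo-keysAtLevel : ∀ {k} n (W : ℕ → ℕ) → k ≤ n →
                      sumTo n (λ j → keysAtLevel k j * W j) ≡ sumTo n (λ j → (j ∸ 1) * W j) + sumTo k W
  sumTo-keysAtLevel {k} n W k≤n = begin
    sumTo n (λ j → keysAtLevel k j * W j)
      ≡⟨ sumTo-cong n (λ j _ _ → *-distribʳ-+ (W j) (j ∸ 1) [ j ≤ k ]) ⟩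
    sumTo n (λ j → (j ∸ 1) * W j + [ j ≤ k ] * W j)
      ≡⟨ sumTo-+ n (λ j → (j ∸ 1) * W j) (λ j → [ j ≤ k ] * W j) ⟩
    sumTo n (λ j → (j ∸ 1) * W j) + sumTo n (λ j → [ j ≤ k ] * W j)
      ≡⟨ cong (sumTo n (λ j → (j ∸ 1) * W j) +_) (sumTo-truncate n W k≤n) ⟩
    sumTo n (λ j → (j ∸ 1) * W j) + sumTo k W ∎
    where open ≡-Reasoning

  keysAtLevel-cost : ∀ {h k} → k ≤ h →
    6 * sumTo h (λ j → keysAtLevel k j * j) + 2 * h ≡ 2 * h * h * h + 3 * k * k + 3 * k
  keysAtLevel-cost {h} {k} k≤h = begin
    6 * sumTo h (λ j → keysAtLevel k j * j) + 2 * h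
      ≡⟨ cong (λ x → 6 * x + 2 * h) (sumTo-keysAtLevel h (λ j → j) k≤h) ⟩
    6 * (S + T) + 2 * h
      ≡⟨ regroup S T h ⟩
    2 * (3 * S + h) + 3 * (2 * T)
      ≡⟨ cong₂ (λ x y → 2 * x + 3 * y) (sumTo-pronic h) (sumTo-id k) ⟩
    2 * (h * h * h) + 3 * (k * suc k)
      ≡⟨ expand h k ⟩
    2 * h * h * h + 3 * k * k + 3 * k ∎
    where
    open ≡-Reasoning
    S = sumTo h (λ j → (j ∸ 1) * j)
    T = sumTo k (λ j → j)
    regroup : ∀ S T h → 6 * (S + T) + 2 * h ≡ 2 * (3 * S + h) + 3 * (2 * T)
    regroup = solve-∀
    expand : ∀ h k → 2 * (h * h * h) + 3 * (k * suc k) ≡ 2 * h * h * h + 3 * k * k + 3 * k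
    expand = solve-∀

  keysAtLevel-count : ∀ {h k} → k ≤ h → 2 * sumTo h (λ j → keysAtLevel k j * 1) + h ≡ h * h + 2 * k
  keysAtLevel-count {h} {k} k≤h = begin
    2 * sumTo h (λ j → keysAtLevel k j * 1) + h
      ≡⟨ cong (λ x → 2 * x + h) (sumTo-keysAtLevel h (λ _ → 1) k≤h) ⟩
    2 * (S + T) + h
      ≡⟨ regroup S T h ⟩
    (2 * S + h) + 2 * T
      ≡⟨ cong₂ (λ x y → x + 2 * y) (sumTo-pred h) (sumTo-const k 1) ⟩
    h * h + 2 * (k * 1)
      ≡⟨ cong (λ x → h * h + 2 * x) (*-identityʳ k) ⟩
    h * h + 2 * k ∎
    where
    open ≡-Reasoning
    S = sumTo h (λ j → (j ∸ 1) * 1)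
    T = sumTo k (λ _ → 1)
    regroup : ∀ S T h → 2 * (S + T) + h ≡ (2 * S + h) + 2 * T
    regroup = solve-∀

  bound-DR : ∀ r c {n} → suc r + c ≤ n → r + suc c ≤ n
  bound-DR r c {n} = subst (_≤ n) (sym (+-suc r c))

  module _ {h : ℕ} {L : Filling} (lds : IsLDS h L) where
    open IsLDS lds

    data InteriorEntry (r c : ℕ) : Set where
      blocked : r + c ≡ h + 3 → h + 2 ≤ c + m → L r c ≡ ∞ → InteriorEntry r c
      proper  : ∀ n → L r c ≡ fin (suc n) → ¬ (r + c ≡ h + 3 × h + 2 ≤ c + m) → InteriorEntry r c

    interiorEntry : ∀ {r c} → Interior h r c → InteriorEntry r c
    interiorEntry {r} {c} (2≤r , 2≤c , r+c≤) with (r + c ≟ h + 3) ×-dec (h + 2 ≤? c + m)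
    ... | yes (diag , right) = blocked diag right (diagNext r c 2≤r diag right)
    ... | no notBlocked with rest r c 2≤r 2≤c r+c≤ notBlocked
    ...   | suc n , _ , eq = proper n eq notBlocked

    keyAt-interior : ∀ {r c K} → KeyAt h L r c K → Interior h r c
    keyAt-interior {r} {c} ((1≤r , 1≤c , r+c≤) , 0<K , eq) = 2≤r , 2≤c , r+c≤h+3
      where
      notZero : L r c ≢ fin 0
      notZero eq′ = <-irrefl (fin-injective (trans (sym eq′) eq)) 0<K
      2≤r : 2 ≤ r
      2≤r with m≤n⇒m<n∨m≡n 1≤r
      ... | inj₁ 1<r = 1<r
      ... | inj₂ refl = ⊥-elim (notZero (row1 c (1≤r , 1≤c , r+c≤)))
      2≤c : 2 ≤ c
      2≤c with m≤n⇒m<n∨m≡n 1≤c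
      ... | inj₁ 1<c = 1<c
      ... | inj₂ refl = ⊥-elim (notZero (col1 r (1≤r , 1≤c , r+c≤)))
      r+c≤h+3 : r + c ≤ h + 3
      r+c≤h+3 with m≤n⇒m<n∨m≡n r+c≤
      ... | inj₁ r+c<h+4 = ≤-pred (subst (r + c <_) (+-suc h 3) r+c<h+4)
      ... | inj₂ diag = ⊥-elim (fin≢∞ (trans (sym eq) (diagTop r c 2≤r 2≤c diag)))

    keyAt-intro : ∀ {r c n} → 1 ≤ r → 2 ≤ c → r + c ≤ h + 3 → L r c ≡ fin (suc n) →
                  KeyAt h L r c (suc n)
    keyAt-intro 1≤r 2≤c r+c≤ eq =
      (1≤r , ≤-trans (s≤s z≤n) 2≤c , ≤-trans r+c≤ (+-monoʳ-≤ h (n≤1+n 3))) , s≤s z≤n , eq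

    blocked-interior : ∀ {r c} → Interior h r c → L r c ≡ ∞ → (r + c ≡ h + 3) × (h + 2 ≤ c + m)
    blocked-interior int eq with interiorEntry int
    ... | blocked diag right _ = diag , right
    ... | proper _ eq′ _ = ⊥-elim (fin≢∞ (trans (sym eq′) eq))

    interior-nonzero : ∀ {r c} → Interior h r c → L r c ≢ fin 0
    interior-nonzero int eq with interiorEntry int
    ... | blocked _ _ eq′ = fin≢∞ (trans (sym eq) eq′)
    ... | proper _ eq′ _ = 0≢1+n (fin-injective (trans (sym eq) eq′))

    module _ {K r₀ c₀ : ℕ} (key : KeyAt h L r₀ c₀ K) where
      private
        L[r₀,c₀] : L r₀ c₀ ≡ fin K
        L[r₀,c₀] = proj₂ (proj₂ key)

        2≤r₀ : 2 ≤ r₀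
        2≤r₀ with keyAt-interior key
        ... | 2≤r₀ , _ = 2≤r₀

        ≤∧≢suc⇒≤ : ∀ {a b} → a ≤ suc b → a ≢ suc b → a ≤ b
        ≤∧≢suc⇒≤ a≤ a≢ = ≤-pred (≤∧≢⇒< a≤ a≢)

        target-row : ∀ {r c} → Reachable r c r₀ c₀ → r₀ ≡ r → L r c ≡ fin K
        target-row {r} {c} (_ , c≤c₀ , diag≤) r₀≡r =
          subst₂ (λ a b → L a b ≡ fin K) r₀≡r c₀≡c L[r₀,c₀]
          where
          c₀≡c : c₀ ≡ c
          c₀≡c = ≤-antisym (+-cancelˡ-≤ r₀ c₀ c (subst (λ x → r₀ + c₀ ≤ x + c) (sym r₀≡r) diag≤)) c≤c₀

        row-below : ∀ {r c} → Reachable (suc r) c r₀ c₀ → L (suc r) c ≢ fin K → r₀ ≤ r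
        row-below reach@(r₀≤ , _) ne = ≤∧≢suc⇒≤ r₀≤ (λ r₀≡ → ne (target-row reach r₀≡))

        step-∞ : ∀ {r c} → Reachable (suc r) c r₀ c₀ → 2 ≤ c → suc r + c ≤ h + 3 →
                 L (suc r) c ≡ ∞ → Reachable r c r₀ c₀
        step-∞ {r} {c} reach@(r₀≤ , c≤c₀ , diag≤) 2≤c r+c≤ eq =
          row-below reach (λ eq′ → fin≢∞ (trans (sym eq′) eq)) , c≤c₀ , ≤∧≢suc⇒≤ diag≤ sameDiagonal
          where
          sameDiagonal : r₀ + c₀ ≢ suc r + c
          sameDiagonal diag≡ with blocked-interior (≤-trans 2≤r₀ r₀≤ , 2≤c , r+c≤) eq
          ... | onDiag , right = fin≢∞ (trans (sym L[r₀,c₀])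
                  (diagNext r₀ c₀ 2≤r₀ (trans diag≡ onDiag) (≤-trans right (+-monoˡ-≤ m c≤c₀))))

        step-right : ∀ {r c n} → Reachable (suc r) c r₀ c₀ → 2 ≤ c → suc r + c ≤ h + 3 →
                     L (suc r) c ≡ fin (suc n) → K ≢ suc n → suc n < K → Reachable r (suc c) r₀ c₀
        step-right {r} {c} {n} reach@(r₀≤ , c≤c₀ , diag≤) 2≤c r+c≤ eq K≢ n<K =
          r₀≤r , ≤∧≢⇒< c≤c₀ sameColumn , subst (r₀ + c₀ ≤_) (sym (+-suc r c)) diag≤
          where
          r₀≤r = row-below reach (λ eq′ → K≢ (fin-injective (trans (sym eq′) eq)))
          sameColumn : c ≢ c₀
          sameColumn refl = <-asym n<K
            (colInc r₀ (suc r) c K (suc n) key (keyAt-intro (s≤s z≤n) 2≤c r+c≤ eq) (s≤s r₀≤r))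

        step-down : ∀ {r c n} → Reachable (suc r) c r₀ c₀ → 2 ≤ c → suc r + c ≤ h + 3 →
                    L (suc r) c ≡ fin (suc n) → K ≢ suc n → ¬ suc n < K → Reachable r c r₀ c₀
        step-down {r} {c} {n} reach@(r₀≤ , c≤c₀ , diag≤) 2≤c r+c≤ eq K≢ n≮K =
          r₀≤r , c≤c₀ , ≤∧≢suc⇒≤ diag≤ sameDiagonal
          where
          r₀≤r = row-below reach (λ eq′ → K≢ (fin-injective (trans (sym eq′) eq)))
          sameDiagonal : r₀ + c₀ ≢ suc r + c
          sameDiagonal diag≡ = n≮K (diagInc (suc r) c r₀ c₀ (suc n) K
            (keyAt-intro (s≤s z≤n) 2≤c r+c≤ eq) key (sym diag≡)
            (≤∧≢⇒< c≤c₀ λ { refl → <⇒≱ (s≤s r₀≤r) (≤-reflexive (sym (+-cancelʳ-≡ c r₀ (suc r) diag≡))) }))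

        one-more : ∀ {r} → r₀ ≤ r →
                   _≡_ {A = Outcome × ℕ} (present , suc (suc (r ∸ r₀))) (present , suc (suc r ∸ r₀))
        one-more r₀≤r = cong (λ s → present , suc s) (sym (+-∸-assoc 1 r₀≤r))

        found-here : ∀ {r} → r ≡ r₀ → _≡_ {A = Outcome × ℕ} (present , 1) (present , suc (r ∸ r₀))
        found-here refl rewrite n∸n≡0 r₀ = refl

      search-present : ∀ r c → 2 ≤ c → r + c ≤ h + 3 → Reachable r c r₀ c₀ →
                       search L K r c ≡ (present , suc (r ∸ r₀))
      search-present zero c _ _ (r₀≤0 , _) = ⊥-elim (<⇒≱ (≤-trans (s≤s z≤n) 2≤r₀) r₀≤0)
      search-present (suc r) c 2≤c r+c≤ reach with L (suc r) c in eq
      ... | ∞ with step-∞ reach 2≤c r+c≤ eq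
      ...   | reach′ rewrite search-present r c 2≤c (<⇒≤ r+c≤) reach′ = one-more (proj₁ reach′)
      search-present (suc r) c 2≤c r+c≤ reach@(r₀≤ , _) | fin zero =
        ⊥-elim (interior-nonzero (≤-trans 2≤r₀ r₀≤ , 2≤c , r+c≤) eq)
      search-present (suc r) c 2≤c r+c≤ reach | fin (suc n) with K ≟ suc n
      ... | yes refl = found-here (proj₁ (distinct (suc r) c r₀ c₀ K here key))
        where here = keyAt-intro (s≤s z≤n) 2≤c r+c≤ eq
      ... | no K≢ with suc n <? K
      ...   | yes n<K with step-right reach 2≤c r+c≤ eq K≢ n<K
      ...     | reach′ rewrite search-present r (suc c) (≤-trans 2≤c (n≤1+n c)) (bound-DR r c r+c≤) reach′ =
        one-more (proj₁ reach′)
      search-present (suc r) c 2≤c r+c≤ reach | fin (suc n) | no K≢ | no n≮K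
        with step-down reach 2≤c r+c≤ eq K≢ n≮K
      ... | reach′ rewrite search-present r c 2≤c (<⇒≤ r+c≤) reach′ = one-more (proj₁ reach′)

    private
      key≢0 : ∀ {e n} → e ≡ fin (suc n) → e ≢ fin 0
      key≢0 refl ()

      blocked≢0 : ∀ {e} → e ≡ ∞ → e ≢ fin 0
      blocked≢0 refl ()

      above-row1 : ∀ {r c} → 2 ≤ c → suc r + c ≤ h + 3 → L (suc r) c ≢ fin 0 → 1 ≤ r
      above-row1 {zero} {c} 2≤c r+c≤ ne =
        ⊥-elim (ne (row1 c (s≤s z≤n , ≤-trans (s≤s z≤n) 2≤c , ≤-trans r+c≤ (+-monoʳ-≤ h (n≤1+n 3)))))
      above-row1 {suc r} _ _ _ = s≤s z≤n

    search-absent : ∀ {K} → (∀ r c → ¬ KeyAt h L r c K) →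
                    ∀ r c → 1 ≤ r → 2 ≤ c → r + c ≤ h + 3 → search L K r c ≡ (absent , r)
    search-absent {K} noKey (suc r) c _ 2≤c r+c≤ with L (suc r) c in eq
    ... | ∞ rewrite search-absent noKey r c (above-row1 2≤c r+c≤ (blocked≢0 eq)) 2≤c (<⇒≤ r+c≤) = refl
    ... | fin zero with r
    ...   | zero = refl
    ...   | suc r′ = ⊥-elim (interior-nonzero (s≤s (s≤s z≤n) , 2≤c , r+c≤) eq)
    search-absent {K} noKey (suc r) c _ 2≤c r+c≤ | fin (suc n) with K ≟ suc n
    ... | yes refl = ⊥-elim (noKey (suc r) c (keyAt-intro (s≤s z≤n) 2≤c r+c≤ eq))
    ... | no _ with suc n <? K
    ...   | yes _ rewrite search-absent noKey r (suc c) (above-row1 2≤c r+c≤ (key≢0 eq))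
                                        (≤-trans 2≤c (n≤1+n c)) (bound-DR r c r+c≤) = refl
    ...   | no _ rewrite search-absent noKey r c (above-row1 2≤c r+c≤ (key≢0 eq)) 2≤c (<⇒≤ r+c≤) = refl

    comparisons-absent : ∀ {K} → ¬ IsProperKey h L K → comparisons h L K ≡ h + 1
    comparisons-absent notKey =
      cong proj₂ (search-absent (λ r c key → notKey (r , c , key)) (h + 1) 2
                                (m≤n+m 1 h) ≤-refl (≤-reflexive (+-assoc h 1 2)))

    comparisons-key : ∀ {K r₀ c₀} → KeyAt h L r₀ c₀ K → comparisons h L K + r₀ ≡ h + 2
    comparisons-key {K} {r₀} {c₀} key with keyAt-interior key
    ... | int@(_ , 2≤c₀ , r₀+c₀≤) = begin
      comparisons h L K + r₀ ≡⟨ cong (λ s → proj₂ s + r₀) found ⟩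
      suc (h + 1 ∸ r₀) + r₀  ≡⟨ cong suc (m∸n+n≡m r₀≤h+1) ⟩
      suc (h + 1)            ≡⟨ +-suc h 1 ⟨
      h + 2                  ∎
      where
      open ≡-Reasoning
      r₀≤h+1 = proj₁ (interior-bounds int)
      found : searchLDS h L K ≡ (present , suc (h + 1 ∸ r₀))
      found = search-present key (h + 1) 2 ≤-refl (≤-reflexive (+-assoc h 1 2))
                (r₀≤h+1 , 2≤c₀ , subst (r₀ + c₀ ≤_) (sym (+-assoc h 1 2)) r₀+c₀≤)

    -- the number of proper keys on diagonal h + 2 (length-diagKeys)
    k : ℕ
    k = h ∸ m

    private
      h+2≡k+2+m : h + 2 ≡ suc (suc k) + m
      h+2≡k+2+m = trans (cong (_+ 2) (sym (m∸n+n≡m (m+n≤o⇒m≤o m m≤h-1)))) (+-comm (k + m) 2)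

    module _ (F : ℕ → ℕ) where

      cellWeight-nonInterior : ∀ {r c} → InD h r c → ¬ Interior h r c → cellWeight L F r c ≡ 0
      cellWeight-nonInterior {r} {c} inD notInterior with L r c in eq
      ... | fin zero    = refl
      ... | ∞           = refl
      ... | fin (suc n) = ⊥-elim (notInterior (keyAt-interior (inD , s≤s z≤n , eq)))

      cellWeight-proper : ∀ {r c v} → (∀ {K} → KeyAt h L r c K → F K ≡ v) → Interior h r c →
                          ¬ (r + c ≡ h + 3 × h + 2 ≤ c + m) → cellWeight L F r c ≡ v
      cellWeight-proper F-v int@(2≤r , 2≤c , r+c≤) notBlocked with interiorEntry int
      ... | blocked diag right _ = ⊥-elim (notBlocked (diag , right))
      ... | proper n eq _ =
        trans (cellWeight-key {L} eq) (F-v (keyAt-intro (≤-trans (s≤s z≤n) 2≤r) 2≤c r+c≤ eq))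

      cellWeight-diagonal : ∀ {r c v} → (∀ {K} → KeyAt h L r c K → F K ≡ v) → 2 ≤ r → 2 ≤ c →
                            r + c ≡ h + 3 → cellWeight L F r c ≡ [ c ≤ suc k ] * v
      cellWeight-diagonal {r} {c} {v} F-v 2≤r 2≤c diag with h + 2 ≤? c + m
      ... | yes right
        rewrite diagNext r c 2≤r diag right
              | [≤]-no {c} {suc k} (+-cancelʳ-≤ m (suc (suc k)) c (subst (_≤ c + m) h+2≡k+2+m right))
        = refl
      ... | no notRight
        rewrite [≤]-yes {c} {suc k}
                  (+-cancelʳ-≤ m c (suc k) (≤-pred (subst (c + m <_) h+2≡k+2+m (≰⇒> notRight))))
        = trans (cellWeight-proper F-v (2≤r , 2≤c , ≤-reflexive diag) (λ (_ , right) → notRight right))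
                (sym (+-identityʳ v))

      rowWeight-empty : ∀ {r} → 1 ≤ r → (∀ {c} → InD h r c → ¬ Interior h r c) → rowWeight h L F r ≡ 0
      rowWeight-empty {r} 1≤r noInterior = begin
        sumTo (h + 4 ∸ r) (cellWeight L F r) ≡⟨ sumTo-cong (h + 4 ∸ r) empty ⟩
        sumTo (h + 4 ∸ r) (λ _ → 0)          ≡⟨ sumTo-const (h + 4 ∸ r) 0 ⟩
        (h + 4 ∸ r) * 0                       ≡⟨ *-zeroʳ (h + 4 ∸ r) ⟩
        0                                     ∎
        where
        open ≡-Reasoning
        empty : ∀ c → 1 ≤ c → c ≤ h + 4 ∸ r → cellWeight L F r c ≡ 0
        empty c 1≤c c≤ = cellWeight-nonInterior inD (noInterior inD)
          where inD = 1≤r , 1≤c , +-≤-from-∸ 1≤c c≤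

      -- Column 1 of row r holds 0, columns 2 … j + 1 hold keys, column j + 2 lies on diagonal h + 2
      -- and column j + 3 on diagonal h + 3.
      rowWeight-level : ∀ {r j v} → (∀ {c K} → KeyAt h L r c K → F K ≡ v) → 2 ≤ r →
                        r + suc j ≡ h + 2 → rowWeight h L F r ≡ keysAtLevel k (suc j) * v
      rowWeight-level {r} {j} {v} F-v 2≤r level = begin
        sumTo (h + 4 ∸ r) cw
          ≡⟨ cong (λ n → sumTo n cw) width ⟩
        sumTo (suc j) cw + cw (2 + j) + cw (3 + j)
          ≡⟨ cong₂ (λ a b → a + b + cw (3 + j)) (sumTo-suc j cw)
                   (cellWeight-diagonal F-v 2≤r (s≤s (s≤s z≤n)) diagonal) ⟩
        cw 1 + sumTo j (λ i → cw (suc i)) + [ suc j ≤ k ] * v + cw (3 + j)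
          ≡⟨ cong₂ (λ a b → a + b + [ suc j ≤ k ] * v + cw (3 + j)) firstColumn below ⟩
        0 + j * v + [ suc j ≤ k ] * v + cw (3 + j)
          ≡⟨ cong (0 + j * v + [ suc j ≤ k ] * v +_) lastColumn ⟩
        0 + j * v + [ suc j ≤ k ] * v + 0
          ≡⟨ regroup j [ suc j ≤ k ] v ⟩
        keysAtLevel k (suc j) * v ∎
        where
        open ≡-Reasoning
        cw = cellWeight L F r
        1≤r = ≤-trans (s≤s z≤n) 2≤r
        h+2<h+3 : h + 2 < h + 3
        h+2<h+3 = +-monoʳ-< h ≤-refl
        diagonal : r + suc (suc j) ≡ h + 3
        diagonal = trans (+-suc r (suc j)) (trans (cong suc level) (sym (+-suc h 2)))
        top : r + suc (suc (suc j)) ≡ h + 4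
        top = trans (+-suc r (suc (suc j))) (trans (cong suc diagonal) (sym (+-suc h 3)))
        width : h + 4 ∸ r ≡ 3 + j
        width = trans (cong (_∸ r) (sym top)) (m+n∸m≡n r (3 + j))
        firstColumn : cw 1 ≡ 0
        firstColumn = cellWeight-nonInterior
          (1≤r , ≤-refl , ≤-trans (+-monoʳ-≤ r (s≤s z≤n)) (≤-reflexive top))
          λ { (_ , s≤s () , _) }
        below : sumTo j (λ i → cw (suc i)) ≡ j * v
        below = trans (sumTo-cong j λ i 1≤i i≤j →
                         let r+1+i≤h+2 = ≤-trans (+-monoʳ-≤ r (s≤s i≤j)) (≤-reflexive level) in
                         cellWeight-proper F-v (2≤r , s≤s 1≤i , ≤-trans r+1+i≤h+2 (<⇒≤ h+2<h+3))
                           λ (onDiagonal , _) → <⇒≱ h+2<h+3 (subst (_≤ h + 2) onDiagonal r+1+i≤h+2))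
                      (sumTo-const j v)
        lastColumn : cw (3 + j) ≡ 0
        lastColumn = cellWeight-nonInterior (1≤r , s≤s z≤n , ≤-reflexive top)
          λ (_ , _ , r+c≤h+3) → <⇒≱ (+-monoʳ-< h ≤-refl) (subst (_≤ h + 3) top r+c≤h+3)
        regroup : ∀ j x v → 0 + j * v + x * v + 0 ≡ (j + x) * v
        regroup = solve-∀

      sum-properKeys : (W : ℕ → ℕ) → (∀ {r c K} j → KeyAt h L r c K → r + j ≡ h + 2 → F K ≡ W j) →
                       sum (map F (properKeys h L)) ≡ sumTo h (λ j → keysAtLevel k j * W j)
      sum-properKeys W F-W = begin
        sum (map F (properKeys h L))
          ≡⟨ sum-map-properKeys h L F ⟩
        sumTo (h + 3) RW
          ≡⟨ cong (λ n → sumTo n RW) (+-comm h 3) ⟩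
        sumTo (suc h) RW + RW (2 + h) + RW (3 + h)
          ≡⟨ cong₂ (λ a b → sumTo (suc h) RW + a + b) (topRow h+2≤2+h) (topRow (≤-trans h+2≤2+h (n≤1+n _))) ⟩
        sumTo (suc h) RW + 0 + 0
          ≡⟨ cong (_+ 0) (+-identityʳ _) ⟩
        sumTo (suc h) RW + 0
          ≡⟨ +-identityʳ _ ⟩
        sumTo (suc h) RW
          ≡⟨ sumTo-suc h RW ⟩
        RW 1 + sumTo h (λ i → RW (suc i))
          ≡⟨ cong (_+ sumTo h (λ i → RW (suc i))) firstRow ⟩
        sumTo h (λ i → RW (suc i))
          ≡⟨ sumTo-reflect h levels ⟩
        sumTo h (λ j → keysAtLevel k j * W j) ∎
        where
        open ≡-Reasoning
        RW = rowWeight h L F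
        firstRow : RW 1 ≡ 0
        firstRow = rowWeight-empty ≤-refl λ _ → λ { (s≤s () , _) }
        h+2≤2+h : h + 2 ≤ 2 + h
        h+2≤2+h = ≤-reflexive (+-comm h 2)
        topRow : ∀ {d} → h + 2 ≤ suc d → RW (suc d) ≡ 0
        topRow h+2≤r = rowWeight-empty (s≤s z≤n) λ _ → beyond-interior (inj₁ h+2≤r)
        levels : ∀ i j → 1 ≤ i → 1 ≤ j → i + j ≡ suc h → RW (suc i) ≡ keysAtLevel k j * W j
        levels i (suc j) 1≤i _ i+j≡ = rowWeight-level (λ key → F-W (suc j) key level) (s≤s 1≤i) level
          where
          level : suc i + suc j ≡ h + 2
          level = trans (cong suc i+j≡) (+-comm 2 h)

    length-diagKeys : length (diagKeys h L) ≡ k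
    length-diagKeys = begin
      length (diagKeys h L)
        ≡⟨ length≡sum-map-const (diagKeys h L) ⟩
      sum (map one (concatMap (λ j → keyOf (L (h + 3 ∸ j) j)) (map suc (upTo (h + 2)))))
        ≡⟨ sum-map-concatMap one (λ j → keyOf (L (h + 3 ∸ j) j)) (map suc (upTo (h + 2))) ⟩
      sum (map D (map suc (upTo (h + 2))))
        ≡⟨ sum-map-upTo D (h + 2) ⟩
      sumTo (h + 2) D
        ≡⟨ cong (λ n → sumTo n D) (+-comm h 2) ⟩
      sumTo (suc h) D + D (2 + h)
        ≡⟨ cong₂ _+_ (sumTo-suc h D) lastCell ⟩
      D 1 + sumTo h (λ i → D (suc i)) + 0
        ≡⟨ cong (λ x → x + sumTo h (λ i → D (suc i)) + 0) firstCell ⟩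
      sumTo h (λ i → D (suc i)) + 0
        ≡⟨ +-identityʳ _ ⟩
      sumTo h (λ i → D (suc i))
        ≡⟨ sumTo-cong h middle ⟩
      sumTo h (λ i → [ i ≤ k ] * 1)
        ≡⟨ sumTo-truncate h one (m∸n≤m h m) ⟩
      sumTo k one
        ≡⟨ sumTo-const k 1 ⟩
      k * 1
        ≡⟨ *-identityʳ k ⟩
      k ∎
      where
      open ≡-Reasoning
      one : ℕ → ℕ
      one _ = 1
      D : ℕ → ℕ
      D j = cellWeight L one (h + 3 ∸ j) j
      onDiagonal : ∀ {j} → j ≤ h + 3 → h + 3 ∸ j + j ≡ h + 3
      onDiagonal = m∸n+n≡m
      diagonalCell : ∀ {j} → 1 ≤ j → j ≤ h + 2 → InD h (h + 3 ∸ j) j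
      diagonalCell {j} 1≤j j≤h+2 =
        m<n⇒0<n∸m (≤-trans (s≤s j≤h+2) (≤-reflexive (sym (+-suc h 2)))) , 1≤j ,
        ≤-trans (≤-reflexive (onDiagonal (≤-trans j≤h+2 (+-monoʳ-≤ h (n≤1+n 2))))) (+-monoʳ-≤ h (n≤1+n 3))
      firstCell : D 1 ≡ 0
      firstCell = cellWeight-nonInterior one (diagonalCell ≤-refl (≤-trans (s≤s z≤n) (m≤n+m 2 h)))
        λ { (_ , s≤s () , _) }
      lastCell : D (2 + h) ≡ 0
      lastCell = cellWeight-nonInterior one (diagonalCell (s≤s z≤n) (≤-reflexive (+-comm 2 h)))
        (beyond-interior (inj₂ (≤-reflexive (+-comm h 2))))
      middle : ∀ i → 1 ≤ i → i ≤ h → D (suc i) ≡ [ i ≤ k ] * 1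
      middle i 1≤i i≤h = cellWeight-diagonal one (λ _ → refl) (m+n≤o⇒m≤o∸n 2 2+j≤h+3) (s≤s 1≤i)
                           (onDiagonal (m+n≤o⇒n≤o 2 2+j≤h+3))
        where
        2+j≤h+3 : 2 + suc i ≤ h + 3
        2+j≤h+3 = subst (2 + suc i ≤_) (+-comm 3 h) (+-monoʳ-≤ 2 (s≤s i≤h))

    comparisons-bound : ∀ {K r₀ c₀} → KeyAt h L r₀ c₀ K → comparisons h L K ≤ h
    comparisons-bound {K} {r₀} key with keyAt-interior key
    ... | 2≤r₀ , _ = +-cancelʳ-≤ 2 (comparisons h L K) h (begin
      comparisons h L K + 2  ≤⟨ +-monoʳ-≤ (comparisons h L K) 2≤r₀ ⟩
      comparisons h L K + r₀ ≡⟨ comparisons-key key ⟩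
      h + 2                  ∎)
      where open ≤-Reasoning

    total-comparisons : ∀ {k′} → length (diagKeys h L) ≡ k′ →
                        6 * sum (map (comparisons h L) (properKeys h L)) + 2 * h
                          ≡ 2 * h * h * h + 3 * k′ * k′ + 3 * k′
    total-comparisons diag≡ with trans (sym length-diagKeys) diag≡
    ... | refl = trans (cong (λ A → 6 * A + 2 * h) (sum-properKeys (comparisons h L) (λ j → j) level))
                       (keysAtLevel-cost (m∸n≤m h m))
      where
      level : ∀ {r c K} j → KeyAt h L r c K → r + j ≡ h + 2 → comparisons h L K ≡ j
      level {r} j key r+j≡ = +-cancelʳ-≡ r _ j (trans (comparisons-key key) (trans (sym r+j≡) (+-comm r j)))

    number-of-keys : ∀ {k′} → length (diagKeys h L) ≡ k′ → 2 * length (properKeys h L) + h ≡ h * h + 2 * k′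
    number-of-keys diag≡ with trans (sym length-diagKeys) diag≡
    ... | refl = trans (cong (λ N → 2 * N + h) (trans (length≡sum-map-const (properKeys h L))
                                                      (sum-properKeys (λ _ → 1) (λ _ → 1) λ _ _ _ → refl)))
                       (keysAtLevel-count (m∸n≤m h m))


module AverageIdentity where
  open import Data.Nat as ℕ using ()
  open import Data.Integer using (+_; _*_; _-_) renaming (_+_ to _+ℤ_)
  open import Data.Integer.Properties using (pos-+; pos-*)
  open import Data.Integer.Tactic.RingSolver using (solve-∀)
  open import Relation.Binary.PropositionalEquality using (trans; cong; cong₂; module ≡-Reasoning)

  private
    pos-*³ : ∀ a b c → + (a ℕ.* b ℕ.* c) ≡ + a * + b * + c
    pos-*³ a b c = trans (pos-* (a ℕ.* b) c) (cong (_* + c) (pos-* a b))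

  average-identity : ∀ A N h k →
    6 ℕ.* A ℕ.+ 2 ℕ.* h ≡ 2 ℕ.* h ℕ.* h ℕ.* h ℕ.+ 3 ℕ.* k ℕ.* k ℕ.+ 3 ℕ.* k →
    2 ℕ.* N ℕ.+ h ≡ h ℕ.* h ℕ.+ 2 ℕ.* k →
    (+ A) * ((+ 3) * (+ h) * (+ h) - (+ 3) * (+ h) +ℤ (+ 6) * (+ k))
      ≡ ((+ 2) * (+ h) * (+ h) * (+ h) - (+ 2) * (+ h) +ℤ (+ 3) * (+ k) * (+ k) +ℤ (+ 3) * (+ k)) * (+ N)
  average-identity A N h k cost count = begin
    a * (+ 3 * H * H - + 3 * H +ℤ + 6 * K)          ≡⟨ factor a H K ⟩
    + 3 * a * ((H * H +ℤ + 2 * K) - H)              ≡⟨ cong (λ x → + 3 * a * (x - H)) countℤ ⟨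
    + 3 * a * ((+ 2 * n +ℤ H) - H)                  ≡⟨ regroup a n H ⟩
    ((+ 6 * a +ℤ + 2 * H) - + 2 * H) * n            ≡⟨ cong (λ x → (x - + 2 * H) * n) costℤ ⟩
    ((+ 2 * H * H * H +ℤ + 3 * K * K +ℤ + 3 * K) - + 2 * H) * n ≡⟨ reorder n H K ⟩
    (+ 2 * H * H * H - + 2 * H +ℤ + 3 * K * K +ℤ + 3 * K) * n   ∎
    where
    open ≡-Reasoning
    a = + A
    n = + N
    H = + h
    K = + k
    costℤ : + 6 * a +ℤ + 2 * H ≡ + 2 * H * H * H +ℤ + 3 * K * K +ℤ + 3 * K
    costℤ = begin
      + 6 * a +ℤ + 2 * H                      ≡⟨ cong₂ _+ℤ_ (pos-* 6 A) (pos-* 2 h) ⟨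
      + (6 ℕ.* A) +ℤ + (2 ℕ.* h)              ≡⟨ pos-+ (6 ℕ.* A) (2 ℕ.* h) ⟨
      + (6 ℕ.* A ℕ.+ 2 ℕ.* h)                 ≡⟨ cong +_ cost ⟩
      + (2 ℕ.* h ℕ.* h ℕ.* h ℕ.+ 3 ℕ.* k ℕ.* k ℕ.+ 3 ℕ.* k)
        ≡⟨ trans (pos-+ (2 ℕ.* h ℕ.* h ℕ.* h ℕ.+ 3 ℕ.* k ℕ.* k) (3 ℕ.* k))
                 (cong (_+ℤ + (3 ℕ.* k)) (pos-+ (2 ℕ.* h ℕ.* h ℕ.* h) (3 ℕ.* k ℕ.* k))) ⟩
      + (2 ℕ.* h ℕ.* h ℕ.* h) +ℤ + (3 ℕ.* k ℕ.* k) +ℤ + (3 ℕ.* k)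
        ≡⟨ cong₂ _+ℤ_ (cong₂ _+ℤ_ (trans (pos-* (2 ℕ.* h ℕ.* h) h) (cong (_* H) (pos-*³ 2 h h)))
                                 (pos-*³ 3 k k))
                      (pos-* 3 k) ⟩
      + 2 * H * H * H +ℤ + 3 * K * K +ℤ + 3 * K ∎
    countℤ : + 2 * n +ℤ H ≡ H * H +ℤ + 2 * K
    countℤ = begin
      + 2 * n +ℤ H            ≡⟨ cong (_+ℤ H) (pos-* 2 N) ⟨
      + (2 ℕ.* N) +ℤ H        ≡⟨ pos-+ (2 ℕ.* N) h ⟨
      + (2 ℕ.* N ℕ.+ h)       ≡⟨ cong +_ count ⟩
      + (h ℕ.* h ℕ.+ 2 ℕ.* k) ≡⟨ trans (pos-+ (h ℕ.* h) (2 ℕ.* k)) (cong₂ _+ℤ_ (pos-* h h) (pos-* 2 k)) ⟩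
      H * H +ℤ + 2 * K        ∎
    factor : ∀ a H K → a * (+ 3 * H * H - + 3 * H +ℤ + 6 * K) ≡ + 3 * a * ((H * H +ℤ + 2 * K) - H)
    factor = solve-∀
    regroup : ∀ a n H → + 3 * a * ((+ 2 * n +ℤ H) - H) ≡ ((+ 6 * a +ℤ + 2 * H) - + 2 * H) * n
    regroup = solve-∀
    reorder : ∀ n H K → ((+ 2 * H * H * H +ℤ + 3 * K * K +ℤ + 3 * K) - + 2 * H) * n
                        ≡ (+ 2 * H * H * H - + 2 * H +ℤ + 3 * K * K +ℤ + 3 * K) * n
    reorder = solve-∀


open LDS using (comparisons-absent; comparisons-bound; total-comparisons; number-of-keys)
open AverageIdentity using (average-identity)
open import Data.Integer using (ℤ; +_; _*_; _-_) renaming (_+_ to _+ℤ_)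

lemma1 : ∀ (h k : ℕ) (L : Filling) → 1 ≤ h → IsLDS h L →
         length (diagKeys h L) ≡ k → 1 ≤ k → k ≤ h →
         (∀ K → 1 ≤ K → ¬ IsProperKey h L K → comparisons h L K ≡ h + 1)
         × (∀ K → IsProperKey h L K → comparisons h L K ≤ h)
         × ((+ sum (map (comparisons h L) (properKeys h L)))
              * ((+ 3) * (+ h) * (+ h) - (+ 3) * (+ h) +ℤ (+ 6) * (+ k))
            ≡ ((+ 2) * (+ h) * (+ h) * (+ h) - (+ 2) * (+ h)
                 +ℤ (+ 3) * (+ k) * (+ k) +ℤ (+ 3) * (+ k))
              * (+ length (properKeys h L)))
lemma1 h k L _ lds diag≡k _ _ =
    (λ K _ notKey → comparisons-absent lds notKey)
  , (λ { K (_ , _ , key) → comparisons-bound lds key })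
  , average-identity (sum (map (comparisons h L) (properKeys h L))) (length (properKeys h L)) h k
                     (total-comparisons lds diag≡k) (number-of-keys lds diag≡k)
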